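{- For all non-negative integers $n$ and $j\in\{0,1,2\}$, \[T_{3n+2+j}^2=1+3\delta_{j,2}+\sum_{k=1}^n\left\{T_{3k+j+1}^2+3T_{3k+j}^2+4\sum_{i=0}^{3k+j-3}(T_{3k+j-i}+T_{3k+j-i-1})T_{i+2}^2\right\}.\]
   Context: Tribonacci numbers: $T_n=T_{n-1}+T_{n-2}+T_{n-3}+\delta_{n,2}$ for all integers $n$, with $T_n=0$ for $n<2$; $\delta_{i,j}$ is $1$ if $i=j$ and $0$ otherwise. Empty sums are zero. -}

module Defs where

open import Data.Nat using (ℕ; zero; suc; _+_; _*_; _∸_; _≤ᵇ_)
open import Data.Bool using (if_then_else_)

-- Tribonacci numbers on ℕ (T_n = 0 for n < 2 covers all negative indices;
-- every index in the statement is non-negative).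
-- T 0 = 0, T 1 = 0, T 2 = 1, T (n+3) = T (n+2) + T (n+1) + T n.
T : ℕ → ℕ
T zero = 0
T (suc zero) = 0
T (suc (suc zero)) = 1
T (suc (suc (suc n))) = T (suc (suc n)) + T (suc n) + T n

δ : ℕ → ℕ → ℕ
δ zero zero = 1
δ zero (suc _) = 0
δ (suc _) zero = 0
δ (suc i) (suc j) = δ i j

sumBelow : ℕ → (ℕ → ℕ) → ℕ
sumBelow zero f = 0
sumBelow (suc n) f = sumBelow n f + f n

-- Σ_{i=a}^{b} f i (inclusive); empty (= 0) when b < a
sumFromTo : ℕ → ℕ → (ℕ → ℕ) → ℕ
sumFromTo a b f = sumBelow (suc b ∸ a) (λ t → f (a + t))

{-# OPTIONS --safe #-}
-- Writing m = 3k + j, the k-th summand is T_{m+2}² − T_{m−1}², so the sum telescopes in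
-- steps of three down to T_{j+2}² = 1 + 3δ_{j,2}.  Expanding T_{m+2} = T_{m+1} + T_m + T_{m−1}
-- reduces this increment identity to a closed form for the inner sum, a convolution of the
-- tribonacci-like sequence T_{k+1} + T_k with the squares T_{i+2}².  That closed form is
-- bilinear in three consecutive terms of each factor and is proved by induction on the
-- length of the convolution: removing the last term shifts the tribonacci-like factor.
module Submission where

open import Defs
open import Algebra.Properties.CommutativeSemigroup using (xy∙z≈xz∙y; x∙yz≈z∙xy)
open import Data.Nat using (ℕ; zero; suc; _+_; _*_; _∸_; _<_; s≤s)
open import Data.Nat.Properties
  using (+-identityʳ; +-assoc; +-comm; *-assoc; *-distribˡ-+; +-cancelʳ-≡; n∸n≡0; +-∸-assoc;
         m<n⇒m<1+n; n<1+n; <⇒≤pred; +-commutativeSemigroup)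
open import Data.Nat.Tactic.RingSolver using (solve-∀)
open import Function using (_∘_)
open import Relation.Binary.PropositionalEquality
  using (_≡_; refl; sym; cong; cong₂; subst; module ≡-Reasoning)

open ≡-Reasoning

sumBelow-cong : ∀ n {f g : ℕ → ℕ} → (∀ i → i < n → f i ≡ g i) → sumBelow n f ≡ sumBelow n g
sumBelow-cong zero    f≗g = refl
sumBelow-cong (suc n) f≗g =
  cong₂ _+_ (sumBelow-cong n (λ i i<n → f≗g i (m<n⇒m<1+n i<n))) (f≗g n (n<1+n n))

telescope : (s f : ℕ → ℕ) → (∀ k → s (suc k) ≡ s k + f (suc k)) →
            ∀ n → s n ≡ s 0 + sumFromTo 1 n f
telescope s f step zero    = sym (+-identityʳ (s 0))
telescope s f step (suc n) = begin
  s (suc n)                                  ≡⟨ step n ⟩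
  s n + f (suc n)                            ≡⟨ cong (_+ f (suc n)) (telescope s f step n) ⟩
  s 0 + sumFromTo 1 n f + f (suc n)          ≡⟨ +-assoc (s 0) _ _ ⟩
  s 0 + sumFromTo 1 (suc n) f                ∎

-- a = p − n and p + b = q + n give a + b = q, without subtraction.
+-transfer : ∀ {a b n p q} → a + n ≡ p → p + b ≡ q + n → a + b ≡ q
+-transfer {a} {b} {n} {p} {q} a+n≡p p+b≡q+n = +-cancelʳ-≡ n (a + b) q (begin
  a + b + n  ≡⟨ xy∙z≈xz∙y +-commutativeSemigroup a b n ⟩
  a + n + b  ≡⟨ cong (_+ b) a+n≡p ⟩
  p + b      ≡⟨ p+b≡q+n ⟩
  q + n      ∎)

convolution : (ℕ → ℕ) → (ℕ → ℕ) → ℕ → ℕ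
convolution x y n = sumBelow n (λ i → x (n ∸ suc i) * y i)

convolution-suc : ∀ x y n → convolution x y (suc n) ≡ convolution (x ∘ suc) y n + x 0 * y n
convolution-suc x y n = cong₂ _+_
  (sumBelow-cong n (λ i i<n → cong (λ k → x k * y i) (+-∸-assoc 1 i<n)))
  (cong (λ k → x k * y n) (n∸n≡0 n))

IsTribonacciLike : (ℕ → ℕ) → Set
IsTribonacciLike u = ∀ k → u (3 + k) ≡ u (2 + k) + u (1 + k) + u k

squareT : ℕ → ℕ
squareT i = T (2 + i) * T (2 + i)

-- The closed form of twice the convolution below is Φ⁺ − Φ⁻; the two parts are kept on
-- opposite sides of the equation so that everything stays in ℕ.  The ring solver does not
-- unfold definitions, so the polynomial identities below state Φ⁺ and Φ⁻ expanded.
Φ⁺ Φ⁻ : ℕ → ℕ → ℕ → ℕ → ℕ → ℕ → ℕ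
Φ⁺ A B C X Y W = 2 * (A * A * Y) + A * B * W + A * C * (X + W) + B * B * W + B * C * (X + 2 * Y)
Φ⁻ A B C X Y W = 2 * (A * A * W) + 3 * (A * B * X) + 2 * (A * C * Y) + B * B * (X + 2 * Y) + B * C * W

convolution-squareT : ∀ n u → IsTribonacciLike u →
  2 * convolution (λ k → u (suc k) + u k) squareT n + Φ⁻ (T (2 + n)) (T (3 + n)) (T (4 + n)) (u 0) (u 1) (u 2)
    ≡ Φ⁺ (T (2 + n)) (T (3 + n)) (T (4 + n)) (u 0) (u 1) (u 2)
convolution-squareT zero u _ = initial (u 0) (u 1) (u 2)
  where
  initial : ∀ X Y W →
    2 * (1 * 1 * W) + 3 * (1 * 1 * X) + 2 * (1 * 2 * Y) + 1 * 1 * (X + 2 * Y) + 1 * 2 * W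
      ≡ 2 * (1 * 1 * Y) + 1 * 1 * W + 1 * 2 * (X + W) + 1 * 1 * W + 1 * 2 * (X + 2 * Y)
  initial = solve-∀
convolution-squareT (suc n) u u-trib = begin
  2 * convolution x squareT (suc n) + Φ⁻ B C D X Y W
    ≡⟨ cong (λ c → 2 * c + Φ⁻ B C D X Y W) (convolution-suc x squareT n) ⟩
  2 * (c + t) + Φ⁻ B C D X Y W
    ≡⟨ cong (_+ Φ⁻ B C D X Y W) (*-distribˡ-+ 2 c t) ⟩
  2 * c + 2 * t + Φ⁻ B C D X Y W
    ≡⟨ +-assoc (2 * c) (2 * t) _ ⟩
  2 * c + (2 * t + Φ⁻ B C D X Y W)
    ≡⟨ +-transfer {a = 2 * c} (convolution-squareT n (u ∘ suc) (u-trib ∘ suc)) shift ⟩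
  Φ⁺ B C D X Y W ∎
  where
  x : ℕ → ℕ
  x k = u (suc k) + u k
  c t A B C D X Y W : ℕ
  c = convolution (x ∘ suc) squareT n
  t = x 0 * squareT n
  A = T (2 + n)
  B = T (3 + n)
  C = T (4 + n)
  D = T (5 + n)
  X = u 0
  Y = u 1
  W = u 2
  step : ∀ A B C X Y W →
    (2 * (A * A * W) + A * B * (W + Y + X) + A * C * (Y + (W + Y + X)) + B * B * (W + Y + X) + B * C * (Y + 2 * W))
      + (2 * ((Y + X) * (A * A))
         + (2 * (B * B * W) + 3 * (B * C * X) + 2 * (B * (C + B + A) * Y) + C * C * (X + 2 * Y) + C * (C + B + A) * W))
    ≡ (2 * (B * B * Y) + B * C * W + B * (C + B + A) * (X + W) + C * C * W + C * (C + B + A) * (X + 2 * Y))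
      + (2 * (A * A * (W + Y + X)) + 3 * (A * B * Y) + 2 * (A * C * W) + B * B * (Y + 2 * W) + B * C * (W + Y + X))
  step = solve-∀
  shift : Φ⁺ A B C Y W (u 3) + (2 * t + Φ⁻ B C D X Y W) ≡ Φ⁺ B C D X Y W + Φ⁻ A B C Y W (u 3)
  shift = subst (λ V → Φ⁺ A B C Y W V + (2 * t + Φ⁻ B C D X Y W) ≡ Φ⁺ B C D X Y W + Φ⁻ A B C Y W V)
                (sym (u-trib 0)) (step A B C X Y W)

square-recurrence-convolution : ∀ p →
  T (5 + p) * T (5 + p)
    ≡ T (2 + p) * T (2 + p)
      + (T (4 + p) * T (4 + p) + 3 * (T (3 + p) * T (3 + p))
         + 4 * convolution (λ k → T (3 + k) + T (2 + k)) squareT (suc p))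
square-recurrence-convolution p = begin
  C * C                       ≡⟨ sym (+-transfer {a = 4 * c} doubled (identity A B D)) ⟩
  4 * c + (D * D + R)         ≡⟨ sym (x∙yz≈z∙xy +-commutativeSemigroup (D * D) R (4 * c)) ⟩
  D * D + (R + 4 * c)         ∎
  where
  A B C D R c : ℕ
  A = T (3 + p)
  B = T (4 + p)
  C = T (5 + p)
  D = T (2 + p)
  R = B * B + 3 * (A * A)
  c = convolution (λ k → T (3 + k) + T (2 + k)) squareT (suc p)
  closed : 2 * c + Φ⁻ A B C 1 1 2 ≡ Φ⁺ A B C 1 1 2
  closed = convolution-squareT (suc p) (λ k → T (2 + k)) (λ _ → refl)
  doubled : 4 * c + 2 * Φ⁻ A B C 1 1 2 ≡ 2 * Φ⁺ A B C 1 1 2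
  doubled = begin
    4 * c + 2 * Φ⁻ A B C 1 1 2       ≡⟨ cong (_+ 2 * Φ⁻ A B C 1 1 2) (*-assoc 2 2 c) ⟩
    2 * (2 * c) + 2 * Φ⁻ A B C 1 1 2 ≡⟨ sym (*-distribˡ-+ 2 (2 * c) _) ⟩
    2 * (2 * c + Φ⁻ A B C 1 1 2)     ≡⟨ cong (2 *_) closed ⟩
    2 * Φ⁺ A B C 1 1 2               ∎
  identity : ∀ A B D →
    2 * (2 * (A * A * 1) + A * B * 2 + A * (B + A + D) * (1 + 2) + B * B * 2 + B * (B + A + D) * (1 + 2 * 1))
      + (D * D + (B * B + 3 * (A * A)))
    ≡ (B + A + D) * (B + A + D)
      + 2 * (2 * (A * A * 2) + 3 * (A * B * 1) + 2 * (A * (B + A + D) * 1) + B * B * (1 + 2 * 1) + B * (B + A + D) * 2)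
  identity = solve-∀

squareIncrement : ℕ → ℕ
squareIncrement m =
  T (m + 1) * T (m + 1) + 3 * (T m * T m)
  + 4 * sumFromTo 0 (m ∸ 3) (λ i → (T (m ∸ i) + T (m ∸ i ∸ 1)) * (T (i + 2) * T (i + 2)))

squareIncrement-convolution : ∀ p →
  squareIncrement (3 + p)
    ≡ T (4 + p) * T (4 + p) + 3 * (T (3 + p) * T (3 + p))
      + 4 * convolution (λ k → T (3 + k) + T (2 + k)) squareT (suc p)
squareIncrement-convolution p =
  cong₂ (λ a s → a * a + 3 * (T (3 + p) * T (3 + p)) + 4 * s)
        (cong (λ k → T (3 + k)) (+-comm p 1))
        (sumBelow-cong (suc p) λ i i<1+p →
          cong₂ (λ k l → (T k + T (k ∸ 1)) * (T l * T l)) (+-∸-assoc 3 (<⇒≤pred i<1+p)) (+-comm i 2))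

square-recurrence : ∀ p → T (3 + p + 2) * T (3 + p + 2) ≡ T (2 + p) * T (2 + p) + squareIncrement (3 + p)
square-recurrence p = begin
  T (3 + p + 2) * T (3 + p + 2)                     ≡⟨ cong (λ k → T (3 + k) * T (3 + k)) (+-comm p 2) ⟩
  T (5 + p) * T (5 + p)                             ≡⟨ square-recurrence-convolution p ⟩
  T (2 + p) * T (2 + p) + _                         ≡⟨ cong (T (2 + p) * T (2 + p) +_) (sym (squareIncrement-convolution p)) ⟩
  T (2 + p) * T (2 + p) + squareIncrement (3 + p)   ∎

initial-square : ∀ j → j < 3 → T (2 + j) * T (2 + j) ≡ 1 + 3 * δ j 2
initial-square 0 _ = refl
initial-square 1 _ = refl
initial-square 2 _ = refl
initial-square (suc (suc (suc j))) (s≤s (s≤s (s≤s ())))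

mainTheorem9 : (n j : ℕ) → j < 3 →
    T (3 * n + 2 + j) * T (3 * n + 2 + j)
      ≡ 1 + 3 * δ j 2
        + sumFromTo 1 n (λ k →
            T (3 * k + j + 1) * T (3 * k + j + 1)
            + 3 * (T (3 * k + j) * T (3 * k + j))
            + 4 * sumFromTo 0 (3 * k + j ∸ 3) (λ i →
                (T (3 * k + j ∸ i) + T (3 * k + j ∸ i ∸ 1)) * (T (i + 2) * T (i + 2))))
mainTheorem9 n j j<3 = begin
  s n                                                          ≡⟨ telescope s f step n ⟩
  s 0 + sumFromTo 1 n f                                        ≡⟨ cong (_+ sumFromTo 1 n f) (initial-square j j<3) ⟩
  1 + 3 * δ j 2 + sumFromTo 1 n f                              ∎
  where
  s f : ℕ → ℕ
  s k = T (3 * k + 2 + j) * T (3 * k + 2 + j)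
  f k = squareIncrement (3 * k + j)
  step : ∀ k → s (suc k) ≡ s k + f (suc k)
  step k = begin
    s (suc k)                                            ≡⟨ cong (λ m → T m * T m) (e₁ k j) ⟩
    T (3 + p + 2) * T (3 + p + 2)                        ≡⟨ square-recurrence p ⟩
    T (2 + p) * T (2 + p) + squareIncrement (3 + p)      ≡⟨ cong₂ (λ m l → T m * T m + squareIncrement l) (e₂ k j) (e₃ k j) ⟩
    s k + f (suc k)                                      ∎
    where
    p = 3 * k + j
    e₁ : ∀ k j → 3 * suc k + 2 + j ≡ 3 + (3 * k + j) + 2
    e₁ = solve-∀
    e₂ : ∀ k j → 2 + (3 * k + j) ≡ 3 * k + 2 + j
    e₂ = solve-∀
    e₃ : ∀ k j → 3 + (3 * k + j) ≡ 3 * suc k + j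
    e₃ = solve-∀
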